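{- Let $k$ be a positive integer with $3\mid k$. Then $S_3(k;3)\ge 3k-3$.
   Context: For positive integers $k,r$ with $r\mid k$: a solution to $\mathcal{E}$ is a $k$-tuple $(x_1,\dots,x_k)$ of positive integers (not necessarily distinct) with $\sum_{i=1}^{k-1}x_i=x_k$. Given a coloring $\chi$ of a set of positive integers by non-negative integers, a solution is called $r$-zero-sum if $\sum_{i=1}^k\chi(x_i)\equiv 0\pmod r$. $S_3(k;r)$ denotes the minimum positive integer $n$ such that every coloring $\chi:\{1,\dots,n\}\to\{0,1,\dots,r-1\}$ admits an $r$-zero-sum solution to $\mathcal{E}$ with all $x_i\in\{1,\dots,n\}$ (and $\infty$ if no such $n$ exists). -}

module Defs where

open import Data.Nat using (ℕ; zero; suc; _+_; _≤_; _<_)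
open import Data.Nat.Divisibility using (_∣_)
open import Data.Fin using (Fin; zero; suc; toℕ; inject₁; fromℕ)
open import Data.Product using (_×_; ∃)
open import Data.Empty using (⊥)
open import Relation.Binary.PropositionalEquality using (_≡_)
open import Relation.Nullary using (¬_)
open import Function using (_∘_)

sumF : ∀ {m} → (Fin m → ℕ) → ℕ
sumF {zero}  f = 0
sumF {suc m} f = f zero + sumF (f ∘ suc)

-- x : Fin k → ℕ is a k-tuple (x_1,...,x_k), indexed from 0.
-- The equation E : x_1 + ... + x_{k-1} = x_k  (no solutions when k = 0).
SolvesE : (k : ℕ) → (Fin k → ℕ) → Set
SolvesE zero    x = ⊥
SolvesE (suc m) x = sumF (x ∘ inject₁) ≡ x (fromℕ m)

InRange : ∀ {k} → ℕ → (Fin k → ℕ) → Set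
InRange n x = ∀ i → 1 ≤ x i × x i ≤ n

-- a coloring by {0,...,r-1}; only its values on {1,...,n} are relevant
Coloring : ℕ → Set
Coloring r = ℕ → Fin r

ZeroSum : ∀ {k} (r : ℕ) → Coloring r → (Fin k → ℕ) → Set
ZeroSum r χ x = r ∣ sumF (λ i → toℕ (χ (x i)))

HasZeroSumSolution : (k r n : ℕ) → Coloring r → Set
HasZeroSumSolution k r n χ =
  ∃ λ (x : Fin k → ℕ) → InRange n x × SolvesE k x × ZeroSum r χ x

-- S_3(k;r) ≥ b, unfolding the definition of S_3 as a minimum (possibly ∞):
-- every positive integer n < b admits a coloring of {1,...,n} with no
-- r-zero-sum solution.
S3≥ : (k r b : ℕ) → Set
S3≥ k r b = ∀ n → 1 ≤ n → n < b →
  ∃ λ (χ : Coloring r) → ¬ HasZeroSumSolution k r n χ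

module Submission where

-- Write k = m + 1.  For n ≤ 3k − 4 = 3m − 1 colour v by  v + 2 + g v  (mod 3),
-- where the correction g vanishes on [0, m], is 2·[3 ∣ v] on [m+1, 2m−1] and
-- is (v + 2) mod 3 from 2m on.  For a solution y₁ + … + y_m = s the colour sum
-- is ≡ W s + Σ g yᵢ (mod 3) with W s = 2s + g s, because 3 ∣ 2k.

open import Defs
open import Data.Nat using (ℕ; zero; suc; _+_; _*_; _∸_; _≤_; _<_; _≤?_; _<?_; z≤n; s≤s; s≤s⁻¹; _%_; NonZero)
open import Data.Nat.Properties
open import Data.Nat.DivMod using (m%n<n; m%n%n≡m%n; %-distribˡ-+; [m+kn]%n≡m%n)
open import Data.Nat.Divisibility using (_∣_; divides; ∣m∣n⇒∣m+n)
open import Data.Nat.Tactic.RingSolver using (solve-∀)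
open import Data.Fin using (Fin; zero; suc; toℕ; inject₁; fromℕ; fromℕ<)
open import Data.Fin.Properties using (toℕ-fromℕ<)
open import Data.Product using (_×_; ∃; _,_; proj₁; proj₂)
open import Data.Sum using (_⊎_; inj₁; inj₂)
open import Data.Empty using (⊥; ⊥-elim)
open import Relation.Binary.PropositionalEquality
open import Relation.Nullary using (¬_; Dec; yes; no)
open import Function using (_∘_)

sumF-last : ∀ m (f : Fin (suc m) → ℕ) → sumF f ≡ sumF (f ∘ inject₁) + f (fromℕ m)
sumF-last zero    f = +-comm (f zero) 0
sumF-last (suc m) f = begin
  f zero + sumF (f ∘ suc)
    ≡⟨ cong (f zero +_) (sumF-last m (f ∘ suc)) ⟩
  f zero + (sumF (f ∘ suc ∘ inject₁) + f (fromℕ (suc m)))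
    ≡⟨ +-assoc (f zero) _ _ ⟨
  f zero + sumF (f ∘ suc ∘ inject₁) + f (fromℕ (suc m)) ∎
  where open ≡-Reasoning

sumF-+ : ∀ {m} (f h : Fin m → ℕ) → sumF (λ i → f i + h i) ≡ sumF f + sumF h
sumF-+ {zero}  f h = refl
sumF-+ {suc m} f h =
  trans (cong (f zero + h zero +_) (sumF-+ (f ∘ suc) (h ∘ suc)))
        (interchange (f zero) (h zero) (sumF (f ∘ suc)) (sumF (h ∘ suc)))
  where
  interchange : ∀ a b c d → a + b + (c + d) ≡ a + c + (b + d)
  interchange = solve-∀

sumF-const : ∀ m c → sumF {m} (λ _ → c) ≡ m * c
sumF-const zero    c = refl
sumF-const (suc m) c = cong (c +_) (sumF-const m c)

sumF-positive : ∀ {m} (f : Fin m → ℕ) → (∀ i → 1 ≤ f i) → m ≤ sumF f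
sumF-positive {zero}  f pos = z≤n
sumF-positive {suc m} f pos = +-mono-≤ (pos zero) (sumF-positive (f ∘ suc) (pos ∘ suc))

module Congruence (d : ℕ) .{{_ : NonZero d}} where

  infix 4 _≈_
  _≈_ : ℕ → ℕ → Set
  a ≈ b = a % d ≡ b % d

  infix 4 _≉_
  _≉_ : ℕ → ℕ → Set
  a ≉ b = ¬ (a ≈ b)

  ≡⇒≈ : ∀ {a b} → a ≡ b → a ≈ b
  ≡⇒≈ = cong (_% d)

  %-≈ : ∀ a → a % d ≈ a
  %-≈ a = m%n%n≡m%n a d

  +-cong : ∀ {a a′ b b′} → a ≈ a′ → b ≈ b′ → a + b ≈ a′ + b′
  +-cong {a} {a′} {b} {b′} p q = begin
    (a + b) % d                ≡⟨ %-distribˡ-+ a b d ⟩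
    (a % d + b % d) % d        ≡⟨ cong₂ (λ u v → (u + v) % d) p q ⟩
    (a′ % d + b′ % d) % d      ≡⟨ %-distribˡ-+ a′ b′ d ⟨
    (a′ + b′) % d              ∎
    where open ≡-Reasoning

  sumF-cong : ∀ {m} (f h : Fin m → ℕ) → (∀ i → f i ≈ h i) → sumF f ≈ sumF h
  sumF-cong {zero}  f h p = refl
  sumF-cong {suc m} f h p = +-cong (p zero) (sumF-cong (f ∘ suc) (h ∘ suc) (p ∘ suc))

  ∣⇒≈0 : ∀ {a} → d ∣ a → a ≈ 0
  ∣⇒≈0 (divides q refl) = [m+kn]%n≡m%n 0 q d

  +-∣ : ∀ a {b} → d ∣ b → a + b ≈ a
  +-∣ a {b} d∣b = trans (+-cong {a} {a} {b} {0} refl (∣⇒≈0 d∣b)) (≡⇒≈ (+-identityʳ a))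

open Congruence 3

double-plus : ∀ s t → s + s + t ≈ s % 3 + s % 3 + t
double-plus s t = +-cong {s + s} {s % 3 + s % 3} {t} {t}
  (+-cong {s} {s % 3} {s} {s % 3} (sym (%-≈ s)) (sym (%-≈ s))) refl

-- If n positive parts have sum ≤ 2t + n − 3,
-- at most one part is ≥ t, so Σ g over the parts is 0 or g v for one large part
-- v; the other n − 1 parts are ≥ 1, which gives the bound on v.
module LargeParts (t : ℕ) (g : ℕ → ℕ) (g-small : ∀ v → v < t → g v ≡ 0) where

  AtMostOneLarge : ∀ {n} → (Fin n → ℕ) → Set
  AtMostOneLarge {n} f =
    sumF (g ∘ f) ≡ 0 ⊎ ∃ λ v → t ≤ v × v + n ≤ suc (sumF f) × sumF (g ∘ f) ≡ g v

  drop-bound : ∀ a S n → 1 ≤ a → suc (suc (a + S)) < t + t + suc n → suc (suc S) < t + t + n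
  drop-bound (suc a) S n _ h =
    ≤-trans (s≤s (s≤s (s≤s (m≤n+m S a)))) (s≤s⁻¹ (subst (suc (suc (suc a + S)) <_) (+-suc (t + t) n) h))

  small-part : ∀ a S v n → 1 ≤ a → v + n ≤ suc S → v + suc n ≤ suc (a + S)
  small-part (suc a) S v n _ h =
    subst (_≤ suc (suc a + S)) (sym (+-suc v n)) (s≤s (≤-trans h (s≤s (m≤n+m S a))))

  large-part : ∀ a S n → n ≤ S → a + suc n ≤ suc (a + S)
  large-part a S n h = subst (_≤ suc (a + S)) (sym (+-suc a n)) (s≤s (+-monoʳ-≤ a h))

  two-large : ∀ a S v n → t ≤ a → t ≤ v → v + n ≤ suc S → suc (suc (a + S)) < t + t + suc n → ⊥
  two-large a S v n ta tv bound h = <-irrefl refl (≤-trans h too-small)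
    where
    too-small : t + t + suc n ≤ suc (suc (a + S))
    too-small = begin
      t + t + suc n     ≡⟨ +-suc (t + t) n ⟩
      suc (t + t + n)   ≤⟨ s≤s (+-monoˡ-≤ n (+-mono-≤ ta tv)) ⟩
      suc (a + v + n)   ≡⟨ cong suc (+-assoc a v n) ⟩
      suc (a + (v + n)) ≤⟨ s≤s (+-monoʳ-≤ a bound) ⟩
      suc (a + suc S)   ≡⟨ cong suc (+-suc a S) ⟩
      suc (suc (a + S)) ∎
      where open ≤-Reasoning

  at-most-one-large : ∀ {n} (f : Fin n → ℕ) → (∀ i → 1 ≤ f i) →
                      suc (suc (sumF f)) < t + t + n → AtMostOneLarge f
  at-most-one-large {zero}  f pos h = inj₁ refl
  at-most-one-large {suc n} f pos h =
    step (f zero <? t) (at-most-one-large (f ∘ suc) (pos ∘ suc) (drop-bound a S n (pos zero) h))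
    where
    a : ℕ
    a = f zero
    S : ℕ
    S = sumF (f ∘ suc)
    step : Dec (a < t) → AtMostOneLarge (f ∘ suc) → AtMostOneLarge f
    step (yes a<t) (inj₁ rest≡0) = inj₁ (cong₂ _+_ (g-small a a<t) rest≡0)
    step (yes a<t) (inj₂ (v , tv , bound , rest≡gv)) =
      inj₂ (v , tv , small-part a S v n (pos zero) bound , cong₂ _+_ (g-small a a<t) rest≡gv)
    step (no a≮t) (inj₁ rest≡0) =
      inj₂ (a , ≮⇒≥ a≮t , large-part a S n (sumF-positive (f ∘ suc) (pos ∘ suc)) ,
            trans (cong (g a +_) rest≡0) (+-identityʳ (g a)))
    step (no a≮t) (inj₂ (v , tv , bound , _)) = ⊥-elim (two-large a S v n (≮⇒≥ a≮t) tv bound h)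

pred-pos : ∀ {m} → 3 ∣ suc m → 1 ≤ m
pred-pos {zero}  (divides zero    ())
pred-pos {zero}  (divides (suc q) ())
pred-pos {suc m} _ = s≤s z≤n

mid : ℕ → ℕ
mid zero    = 2
mid (suc _) = 0

-- 2s + mid s is 2, 2, 1 for s ≡ 0, 1, 2: never 0.  Closed residues such as
-- 4 % 3 compute, so each case is refuted by an absurd pattern.
double-mid-≉0 : ∀ s → s + s + mid (s % 3) ≉ 0
double-mid-≉0 s eq = residue (s % 3) (m%n<n s 3) (trans (sym (double-plus s _)) eq)
  where
  residue : ∀ r → r < 3 → r + r + mid r ≉ 0
  residue 0 _ ()
  residue 1 _ ()
  residue 2 _ ()
  residue (suc (suc (suc _))) (s≤s (s≤s (s≤s ())))

double-shift-≈2 : ∀ s → s + s + (s + 2) % 3 ≈ 2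
double-shift-≈2 s = begin
  (s + s + (s + 2) % 3) % 3 ≡⟨ +-cong {s + s} {s + s} refl (%-≈ (s + 2)) ⟩
  (s + s + (s + 2)) % 3     ≡⟨ cong (_% 3) (regroup s) ⟩
  (2 + s * 3) % 3           ≡⟨ [m+kn]%n≡m%n 2 s 3 ⟩
  2 % 3                     ∎
  where
  open ≡-Reasoning
  regroup : ∀ s → s + s + (s + 2) ≡ 2 + s * 3
  regroup = solve-∀

two-plus-≉0 : ∀ c → c ≡ 0 ⊎ c ≡ 2 → 2 + c ≉ 0
two-plus-≉0 .0 (inj₁ refl) ()
two-plus-≉0 .2 (inj₂ refl) ()

module Colouring (m : ℕ) where

  g : ℕ → ℕ
  g v with v ≤? m | v <? m + m
  ... | yes _ | _     = 0
  ... | no _  | yes _ = mid (v % 3)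
  ... | no _  | no _  = (v + 2) % 3

  colourValue : ℕ → ℕ
  colourValue v = v + 2 + g v

  χ : Coloring 3
  χ v = fromℕ< (m%n<n (colourValue v) 3)

  toℕ-χ : ∀ v → toℕ (χ v) ≈ colourValue v
  toℕ-χ v = trans (cong (_% 3) (toℕ-fromℕ< (m%n<n (colourValue v) 3))) (%-≈ (colourValue v))

  -- The contribution of the last entry s of a solution to the colour sum.
  W : ℕ → ℕ
  W s = s + s + g s

  g-small : ∀ v → v < suc m → g v ≡ 0
  g-small v (s≤s v≤m) with v ≤? m
  ... | yes _  = refl
  ... | no v≰m = ⊥-elim (v≰m v≤m)

  value-sum : (x : Fin (suc m) → ℕ) → SolvesE (suc m) x →
              sumF (colourValue ∘ x) ≡ W (x (fromℕ m)) + sumF (g ∘ x ∘ inject₁) + (m + m + 2)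
  value-sum x solves = begin
    sumF (λ i → x i + 2 + g (x i))
      ≡⟨ sumF-+ (λ i → x i + 2) (g ∘ x) ⟩
    sumF (λ i → x i + 2) + sumF (g ∘ x)
      ≡⟨ cong (_+ sumF (g ∘ x)) (sumF-+ x (λ _ → 2)) ⟩
    sumF x + sumF {suc m} (λ _ → 2) + sumF (g ∘ x)
      ≡⟨ cong₂ _+_ (cong₂ _+_ (sumF-last m x) (sumF-const (suc m) 2)) (sumF-last m (g ∘ x)) ⟩
    sumF (x ∘ inject₁) + s + suc m * 2 + (G + g s)
      ≡⟨ cong (λ z → z + s + suc m * 2 + (G + g s)) solves ⟩
    s + s + suc m * 2 + (G + g s)
      ≡⟨ regroup s m G (g s) ⟩
    W s + G + (m + m + 2) ∎
    where
    open ≡-Reasoning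
    s : ℕ
    s = x (fromℕ m)
    G : ℕ
    G = sumF (g ∘ x ∘ inject₁)
    regroup : ∀ s m G w → s + s + suc m * 2 + (G + w) ≡ s + s + w + G + (m + m + 2)
    regroup = solve-∀

  module _ (k-div : 3 ∣ suc m) where

    two-k-div : 3 ∣ m + m + 2
    two-k-div = subst (3 ∣_) (double-suc m) (∣m∣n⇒∣m+n k-div k-div)
      where
      double-suc : ∀ m → suc m + suc m ≡ m + m + 2
      double-suc = solve-∀

    -- W s ≡ 2m ≡ 2k − 2 ≡ 1 at the smallest possible s = m.
    W-at-m : m + m + 0 ≉ 0
    W-at-m W≈0 = two-plus-≉0 0 (inj₁ refl)
      (trans (sym (+-cong {m + m + 0} {0} {2} {2} W≈0 refl))
             (trans (cong (λ u → (u + 2) % 3) (+-identityʳ (m + m))) (∣⇒≈0 two-k-div)))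

    colour-sum : (x : Fin (suc m) → ℕ) → SolvesE (suc m) x →
                 sumF (λ i → toℕ (χ (x i))) ≈ W (x (fromℕ m)) + sumF (g ∘ x ∘ inject₁)
    colour-sum x solves =
      trans (sumF-cong (λ i → toℕ (χ (x i))) (colourValue ∘ x) (toℕ-χ ∘ x))
      (trans (≡⇒≈ (value-sum x solves)) (+-∣ (W (x (fromℕ m)) + sumF (g ∘ x ∘ inject₁)) two-k-div))

    W-large : ∀ s → m + m ≤ s → W s ≈ 2
    W-large s 2m≤s with s ≤? m | s <? m + m
    ... | yes s≤m | _        = ⊥-elim (<-irrefl (+-identityʳ m)
                                 (≤-trans (+-monoʳ-< m (pred-pos k-div)) (≤-trans 2m≤s s≤m)))
    ... | no _    | yes s<2m = ⊥-elim (<-irrefl refl (<-≤-trans s<2m 2m≤s))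
    ... | no _    | no _     = double-shift-≈2 s

    -- Without a large part, every feasible s ≥ m has W s ≢ 0.
    W-≉0 : ∀ s → m ≤ s → W s ≉ 0
    W-≉0 s m≤s with s ≤? m | s <? m + m
    ... | yes s≤m | _     = subst (λ v → v + v + 0 ≉ 0) (≤-antisym m≤s s≤m) W-at-m
    ... | no _    | yes _ = double-mid-≉0 s
    ... | no _    | no _  = λ W≈0 → two-plus-≉0 0 (inj₁ refl) (trans (sym (double-shift-≈2 s)) W≈0)

    -- Up to 2m the correction only takes the values 0 and 2 (g (2m) ≡ 2k ≡ 0).
    g-values : ∀ v → v ≤ m + m → g v ≡ 0 ⊎ g v ≡ 2
    g-values v v≤2m with v ≤? m | v <? m + m
    ... | yes _ | _     = inj₁ refl
    ... | no _  | yes _ = mid-values (v % 3)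
      where
      mid-values : ∀ r → mid r ≡ 0 ⊎ mid r ≡ 2
      mid-values zero    = inj₂ refl
      mid-values (suc r) = inj₁ refl
    ... | no _  | no v≮2m = inj₁ (trans (cong (λ u → (u + 2) % 3) (≤-antisym v≤2m (≮⇒≥ v≮2m)))
                                        (∣⇒≈0 two-k-div))

    open LargeParts (suc m) g g-small using (AtMostOneLarge; at-most-one-large)

    no-zero-sum : ∀ n → n < 3 * m → ¬ HasZeroSumSolution (suc m) 3 n χ
    no-zero-sum n n<3m (x , in-range , solves , zero-sum) =
      excluded (at-most-one-large y y-pos sum-bound)
      where
      y : Fin m → ℕ
      y = x ∘ inject₁
      s : ℕ
      s = x (fromℕ m)

      total≈0 : W s + sumF (g ∘ y) ≈ 0
      total≈0 = trans (sym (colour-sum x solves)) (∣⇒≈0 zero-sum)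

      y-pos : ∀ i → 1 ≤ y i
      y-pos i = proj₁ (in-range (inject₁ i))

      m≤s : m ≤ s
      m≤s = subst (m ≤_) solves (sumF-positive y y-pos)

      s<3m : s < 3 * m
      s<3m = ≤-<-trans (proj₂ (in-range (fromℕ m))) n<3m

      sum-bound : suc (suc (sumF y)) < suc m + suc m + m
      sum-bound = subst₂ (λ u w → suc (suc u) < w) (sym solves) (triple-plus-2 m) (s≤s (s≤s s<3m))
        where
        triple-plus-2 : ∀ m → 2 + 3 * m ≡ suc m + suc m + m
        triple-plus-2 = solve-∀

      -- No large part: the colour sum is W s ≉ 0.  One large part v: then
      -- s ≥ 2m and v ≤ 2m, so the colour sum is 2 + g v with g v ∈ {0, 2}.
      excluded : AtMostOneLarge y → ⊥
      excluded (inj₁ G≡0) = W-≉0 s m≤s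
        (trans (cong (_% 3) (sym (+-identityʳ (W s))))
               (trans (cong (λ u → (W s + u) % 3) (sym G≡0)) total≈0))
      excluded (inj₂ (v , k≤v , v-bound , G≡gv)) = two-plus-≉0 (g v) (g-values v v≤2m)
        (trans (+-cong {2} {W s} {g v} {g v} (sym (W-large s 2m≤s)) refl)
               (trans (cong (λ u → (W s + u) % 3) (sym G≡gv)) total≈0))
        where
        v+m≤s+1 : v + m ≤ suc s
        v+m≤s+1 = subst (λ u → v + m ≤ suc u) solves v-bound

        2m≤s : m + m ≤ s
        2m≤s = s≤s⁻¹ (≤-trans (+-monoˡ-≤ m k≤v) v+m≤s+1)

        v≤2m : v ≤ m + m
        v≤2m = +-cancelʳ-≤ m v (m + m) (≤-trans v+m≤s+1 (subst (suc s ≤_) (triple m) s<3m))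
          where
          triple : ∀ m → 3 * m ≡ m + m + m
          triple = solve-∀

3k∸3 : ∀ m → 3 * suc m ∸ 3 ≡ 3 * m
3k∸3 m = trans (cong (_∸ 3) (expand m)) (m+n∸m≡n 3 (3 * m))
  where
  expand : ∀ m → 3 * suc m ≡ 3 + 3 * m
  expand = solve-∀

theorem4 : (k : ℕ) → 0 < k → 3 ∣ k → S3≥ k 3 (3 * k ∸ 3)
theorem4 (suc m) _ k-div n _ n<3k-3 =
  χ , no-zero-sum k-div n (subst (n <_) (3k∸3 m) n<3k-3)
  where open Colouring m
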